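{- Let $T$ be a tree. Then the skew token sliding graph $\mathcal{TS}_-(T)$ contains no edges.
   Context: Skew forcing on a graph $G$: vertices are blue or white; starting from an initial blue set $B$ (possibly empty), repeatedly apply: if any vertex $u$ (blue or white) has exactly one white neighbor $w$, then $w$ becomes blue. $B$ is a skew forcing set if eventually all vertices are blue; $\mathrm{Z}_-(G)$ is the minimum size of a skew forcing set. $\mathcal{TS}_-(G)$ has as vertices the skew forcing sets of size $\mathrm{Z}_-(G)$, with $S_1S_2$ an edge iff there are $v_1\in S_1\setminus S_2$, $v_2\in S_2\setminus S_1$ with $S_1\setminus\{v_1\}=S_2\setminus\{v_2\}$ and $v_1v_2\in E(G)$. -}

module Defs where

open import Data.Nat using (ℕ; _≤_)
open import Data.Fin using (Fin)
open import Data.Fin.Subset using (Subset; _∈_; _∉_; ∣_∣; _-_)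
open import Data.List using (List; []; _∷_; _++_; [_])
open import Data.List.Relation.Unary.Unique.Propositional using (Unique)
open import Data.Product using (Σ; ∃; _×_; _,_)
open import Data.Unit using (⊤)
open import Relation.Nullary using (¬_)
open import Relation.Binary.PropositionalEquality using (_≡_)
open import Relation.Binary.Construct.Closure.ReflexiveTransitive using (Star)

record Graph (n : ℕ) : Set₁ where
  field
    Adj   : Fin n → Fin n → Set
    sym   : ∀ {u v} → Adj u v → Adj v u
    irrefl : ∀ {u} → ¬ Adj u u
open Graph public

module _ {n : ℕ} (G : Graph n) where

  Connected : Set
  Connected = ∀ u v → Star (Adj G) u v

  Chain : Fin n → List (Fin n) → Set
  Chain u []       = ⊤
  Chain u (v ∷ vs) = Adj G u v × Chain v vs

  -- a cycle u, m, ms..., w (at least 3 distinct vertices), closed by the edge w u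
  HasCycle : Set
  HasCycle = Σ (Fin n) λ u → Σ (Fin n) λ m → Σ (List (Fin n)) λ ms → Σ (Fin n) λ w →
    Unique (u ∷ m ∷ ms ++ [ w ]) × Chain u (m ∷ ms ++ [ w ]) × Adj G w u

  IsTree : Set
  IsTree = Connected × ¬ HasCycle

  -- Final blue set of the skew forcing process started from B:
  -- v is blue if v ∈ B, or v is a neighbour of some u (blue or white) all of
  -- whose neighbours other than v are already blue (so v is u's only white
  -- neighbour and gets forced).
  data Blue (B : Subset n) : Fin n → Set where
    initial : ∀ {v} → v ∈ B → Blue B v
    force   : ∀ {u v} → Adj G u v →
              (∀ w → Adj G u w → ¬ w ≡ v → Blue B w) → Blue B v

  IsSkewForcingSet : Subset n → Set
  IsSkewForcingSet B = ∀ v → Blue B v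

  IsMinSkewForcingSet : Subset n → Set
  IsMinSkewForcingSet B =
    IsSkewForcingSet B × (∀ B′ → IsSkewForcingSet B′ → ∣ B ∣ ≤ ∣ B′ ∣)

  TSEdge : Subset n → Subset n → Set
  TSEdge S₁ S₂ =
    IsMinSkewForcingSet S₁ × IsMinSkewForcingSet S₂ ×
    Σ (Fin n) λ v₁ → Σ (Fin n) λ v₂ →
      v₁ ∈ S₁ × v₁ ∉ S₂ × v₂ ∈ S₂ × v₂ ∉ S₁ ×
      (S₁ - v₁) ≡ (S₂ - v₂) × Adj G v₁ v₂

module Submission where

-- Let X = S₁ − v₁ = S₂ − v₂. By minimality neither S₁ nor S₂ can be shrunk, so v₁ and v₂
-- both stay white when skew forcing starts from X; the slide thus needs an edge with both
-- ends white. But in a forest no two white vertices are adjacent: if h and m are adjacent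
-- and white, then h does not force m, so h has another white neighbour x. Walking on
-- this way produces a white path that never closes a cycle, hence longer paths forever,
-- which is impossible in a finite graph. Whiteness is a negative property, so the walk is
-- carried out in the double-negation monad, where "h has another white neighbour" holds.

open import Defs
open import Data.Nat using (ℕ; zero; suc; _≤_; z≤n; s≤s)
open import Data.Nat.Properties using (<⇒≱)
open import Data.Fin using (Fin; _≟_) renaming (zero to fzero; suc to fsuc)
open import Data.Fin.Properties using (∀-cons; injective⇒≤)
open import Data.Fin.Subset using (Subset; _-_) renaming (_∈_ to _∈ₛ_)
open import Data.Fin.Subset.Properties using (x∈p⇒∣p-x∣<∣p∣; x∈p∧x∉q⇒x∈p─q; x≢y⇒x∉⁅y⁆)
open import Data.List using (List; []; _∷_; _++_; [_]; length; lookup)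
open import Data.List.Properties using (++-assoc)
open import Data.List.Relation.Unary.All as All using (All; []; _∷_)
open import Data.List.Relation.Unary.All.Properties using (¬Any⇒All¬; ++⁻ˡ)
open import Data.List.Relation.Unary.AllPairs using ([]; _∷_)
open import Data.List.Relation.Unary.Unique.Propositional using (Unique)
open import Data.List.Relation.Unary.Unique.Propositional.Properties using (Unique[x∷xs]⇒x∉xs)
open import Data.List.Membership.Propositional using (_∈_)
open import Data.List.Membership.Propositional.Properties using (∈-lookup; ∈-∃++)
open import Data.Product using (Σ; ∃; _×_; _,_; proj₁)
open import Data.Unit using (tt)
open import Data.Empty using (⊥; ⊥-elim)
open import Effect.Monad using (RawMonad)
open import Level using (0ℓ)
open import Function using (_∘_)
open import Relation.Nullary using (¬_; yes; no)
open import Relation.Nullary.Negation using (DoubleNegation; ¬¬-Monad)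
open import Relation.Binary.PropositionalEquality
  using (_≡_; _≢_; refl; subst; cong) renaming (sym to ≡-sym)

open RawMonad (¬¬-Monad {0ℓ})

¬¬-→ : {A B : Set} → (A → DoubleNegation B) → DoubleNegation (A → B)
¬¬-→ f ¬[A→B] = ¬[A→B] (λ a → ⊥-elim (f a (λ b → ¬[A→B] (λ _ → b))))

¬¬-∀-Fin : ∀ {n} {P : Fin n → Set} → (∀ i → DoubleNegation (P i)) → DoubleNegation (∀ i → P i)
¬¬-∀-Fin {zero}  ¬¬P = pure λ ()
¬¬-∀-Fin {suc n} ¬¬P = do
  p₀ ← ¬¬P fzero
  ps ← ¬¬-∀-Fin (¬¬P ∘ fsuc)
  pure (∀-cons p₀ ps)

Unique⇒lookup-injective : ∀ {A : Set} {xs : List A} → Unique xs → ∀ {i j} → lookup xs i ≡ lookup xs j → i ≡ j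
Unique⇒lookup-injective {xs = x ∷ xs} _         {fzero}  {fzero}  _ = refl
Unique⇒lookup-injective {xs = x ∷ xs} u         {fzero}  {fsuc j} e =
  ⊥-elim (Unique[x∷xs]⇒x∉xs u (subst (_∈ xs) (≡-sym e) (∈-lookup j)))
Unique⇒lookup-injective {xs = x ∷ xs} u         {fsuc i} {fzero}  e =
  ⊥-elim (Unique[x∷xs]⇒x∉xs u (subst (_∈ xs) e (∈-lookup i)))
Unique⇒lookup-injective {xs = x ∷ xs} (_ ∷ u)   {fsuc i} {fsuc j} e = cong fsuc (Unique⇒lookup-injective u e)

Unique⇒length≤ : ∀ {n} {xs : List (Fin n)} → Unique xs → length xs ≤ n
Unique⇒length≤ u = injective⇒≤ (Unique⇒lookup-injective u)

Unique-++⁻ˡ : ∀ {A : Set} (xs : List A) {ys} → Unique (xs ++ ys) → Unique xs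
Unique-++⁻ˡ []       _         = []
Unique-++⁻ˡ (x ∷ xs) (x∉ ∷ u) = ++⁻ˡ xs x∉ ∷ Unique-++⁻ˡ xs u

module _ {n : ℕ} (G : Graph n) where
  open import Data.List.Membership.DecPropositional (_≟_ {n}) using (_∈?_)

  Chain-++⁻ˡ : ∀ u (xs : List (Fin n)) {ys} → Chain G u (xs ++ ys) → Chain G u xs
  Chain-++⁻ˡ u []       _        = tt
  Chain-++⁻ˡ u (x ∷ xs) (a , c) = a , Chain-++⁻ˡ x xs c

  chord⇒HasCycle : ∀ {h m x} {rest : List (Fin n)} →
    Unique (h ∷ m ∷ rest) → Chain G h (m ∷ rest) → x ∈ rest → Adj G x h → HasCycle G
  chord⇒HasCycle {h} {m} {x} u c x∈rest x~h with pre , post , refl ← ∈-∃++ x∈rest =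
    h , m , pre , x ,
    Unique-++⁻ˡ (h ∷ cycle) (subst Unique (cong (h ∷_) split) u) ,
    Chain-++⁻ˡ h cycle (subst (Chain G h) split c) ,
    x~h
    where
    cycle = m ∷ pre ++ [ x ]
    split : m ∷ pre ++ x ∷ post ≡ cycle ++ post
    split = cong (m ∷_) (≡-sym (++-assoc pre [ x ] post))

  Blue-trans : ∀ {S X} → (∀ x → x ∈ₛ S → Blue G X x) → ∀ {v} → Blue G S v → Blue G X v
  Blue-trans S⊆X (initial v∈S)     = S⊆X _ v∈S
  Blue-trans S⊆X (force u~v others) = force u~v (λ w u~w w≢v → Blue-trans S⊆X (others w u~w w≢v))

  White : Subset n → Fin n → Set
  White X v = ¬ Blue G X v

  minimum⇒White-removed : ∀ {S v} → IsMinSkewForcingSet G S → v ∈ₛ S → White (S - v) v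
  minimum⇒White-removed {S} {v} (forcing , minimal) v∈S v-blue =
    <⇒≱ (x∈p⇒∣p-x∣<∣p∣ v∈S) (minimal (S - v) (Blue-trans S-blue ∘ forcing))
    where
    S-blue : ∀ x → x ∈ₛ S → Blue G (S - v) x
    S-blue x x∈S with x ≟ v
    ... | yes refl = v-blue
    ... | no  x≢v  = initial (x∈p∧x∉q⇒x∈p─q x∈S (x≢y⇒x∉⁅y⁆ x≢v))

  module _ (X : Subset n) where

    otherWhiteNeighbour : ∀ {h m} → Adj G h m → White X m →
      DoubleNegation (∃ λ x → Adj G h x × x ≢ m × White X x)
    otherWhiteNeighbour h~m m-white none =
      ¬¬-∀-Fin (λ w → ¬¬-→ λ h~w → ¬¬-→ λ w≢m w-white → none (w , h~w , w≢m , w-white))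
        (m-white ∘ force h~m)

    record WhitePath : Set where
      field
        head next : Fin n
        rest      : List (Fin n)
        unique    : Unique (head ∷ next ∷ rest)
        chain     : Chain G head (next ∷ rest)
        white     : All (White X) (head ∷ next ∷ rest)

      size : ℕ
      size = length (head ∷ next ∷ rest)
    open WhitePath

    prepend : ¬ HasCycle G → (p : WhitePath) →
      (∃ λ x → Adj G (head p) x × x ≢ next p × White X x) →
      Σ WhitePath λ q → size q ≡ suc (size p)
    prepend acyclic p (x , h~x , x≢m , x-white) with x ∈? rest p
    ... | yes x∈rest = ⊥-elim (acyclic (chord⇒HasCycle (unique p) (chain p) x∈rest (Graph.sym G h~x)))
    ... | no  x∉rest = record
      { head = x ; next = head p ; rest = next p ∷ rest p
      ; unique = (x≢h ∷ x≢m ∷ ¬Any⇒All¬ (rest p) x∉rest) ∷ unique p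
      ; chain = Graph.sym G h~x , chain p
      ; white = x-white ∷ white p
      } , refl
      where
      x≢h : x ≢ head p
      x≢h refl = irrefl G h~x

    extend : ¬ HasCycle G → (p : WhitePath) → DoubleNegation (Σ WhitePath λ q → size q ≡ suc (size p))
    extend acyclic p =
      prepend acyclic p <$> otherWhiteNeighbour (proj₁ (chain p)) (All.head (All.tail (white p)))

    longWhitePath : ¬ HasCycle G → WhitePath → ∀ k → DoubleNegation (Σ WhitePath λ q → k ≤ size q)
    longWhitePath acyclic p zero    = pure (p , z≤n)
    longWhitePath acyclic p (suc k) = do
      (q , k≤q) ← longWhitePath acyclic p k
      (r , r≡q+1) ← extend acyclic q
      pure (r , subst (suc k ≤_) (≡-sym r≡q+1) (s≤s k≤q))

  ¬HasCycle⇒¬whiteEdge : ¬ HasCycle G → ∀ {X u v} → Adj G u v → White X u → White X v → ⊥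
  ¬HasCycle⇒¬whiteEdge acyclic {X} {u} {v} u~v u-white v-white =
    longWhitePath X acyclic edge (suc n) λ (q , n<q) → <⇒≱ n<q (Unique⇒length≤ (WhitePath.unique q))
    where
    edge : WhitePath X
    edge = record
      { head = u ; next = v ; rest = []
      ; unique = ((λ { refl → irrefl G u~v }) ∷ []) ∷ [] ∷ []
      ; chain = u~v , tt
      ; white = u-white ∷ v-white ∷ []
      }

mainTheorem18 : ∀ (n : ℕ) (T : Graph n) → IsTree T →
    ∀ (S₁ S₂ : Subset n) → ¬ TSEdge T S₁ S₂
mainTheorem18 n T (_ , acyclic) S₁ S₂
  (min₁ , min₂ , v₁ , v₂ , v₁∈S₁ , _ , v₂∈S₂ , _ , S₁-v₁≡S₂-v₂ , v₁~v₂) =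
  ¬HasCycle⇒¬whiteEdge T acyclic v₁~v₂
    (minimum⇒White-removed T min₁ v₁∈S₁)
    (subst (λ X → White T X v₂) (≡-sym S₁-v₁≡S₂-v₂) (minimum⇒White-removed T min₂ v₂∈S₂))
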